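{- Let $a,m\in\mathbb{N}$, let $Y_1,\dots,Y_m,Z$ be indeterminates and $M=\{1,\dots,m\}$, and define the rational function $$F_a(Y_1,\dots,Y_m;Z)=\sum_{i=1}^mY_i^a\prod_{l\in M\setminus\{i\}}\frac{1-ZY_l}{1-Y_l/Y_i}.$$ Then $$F_a(Y_1,\dots,Y_m;Z)=\sum_{j=0}^{m-1}q_{a,j}(Y_1,\dots,Y_m)Z^j,$$ where each $q_{a,j}$ is a polynomial in $\mathbb{Q}[Y_1,\dots,Y_m]$ of degree $j+a$. Moreover $q_{1,j}=(-1)^je_{j+1}$, $q_{2,j}=(-1)^{j-1}(e_{j+2}-e_1e_{j+1})$, and in general $q_{a,j}\in\mathbb{Z}[e_1,\dots,e_m]$.
   Context: $e_j=e_j(Y_1,\dots,Y_m)=\sum_{1\le i_1<\cdots<i_j\le m}Y_{i_1}\cdots Y_{i_j}$ is the $j$-th elementary symmetric polynomial for $1\le j\le m$, with $e_0=1$ and $e_{m+1}=0$. -}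

module Defs where

open import Data.Nat as ℕ using (ℕ; zero; suc)
open import Data.Integer as ℤ using (ℤ)
open import Data.Rational using (ℚ; 0ℚ; 1ℚ; _+_; _*_; -_; _-_; 1/_; ≢-nonZero)
open import Data.Rational.Properties using (_≟_)
open import Data.Fin as Fin using (Fin; toℕ)
open import Data.Vec as Vec using (Vec; []; _∷_)
open import Data.Vec.Properties using (≡-dec)
open import Data.List using (List; []; _∷_)
open import Data.Product using (_×_; _,_; ∃; Σ)
open import Function using (_∘_)
open import Relation.Nullary using (yes; no; ¬_)
open import Relation.Binary.PropositionalEquality using (_≡_; _≢_)

-- Total inverse on ℚ (with 1/0 := 0); only ever applied to nonzero
-- arguments under the hypotheses of the theorem.
inv : ℚ → ℚ
inv p with p ≟ 0ℚ
... | yes _ = 0ℚ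
... | no p≢0 = 1/_ p {{≢-nonZero p≢0}}

_^_ : ℚ → ℕ → ℚ
x ^ zero = 1ℚ
x ^ suc n = x * (x ^ n)

sumFin : (n : ℕ) → (Fin n → ℚ) → ℚ
sumFin zero f = 0ℚ
sumFin (suc n) f = f Fin.zero + sumFin n (f ∘ Fin.suc)

prodFin : (n : ℕ) → (Fin n → ℚ) → ℚ
prodFin zero f = 1ℚ
prodFin (suc n) f = f Fin.zero * prodFin n (f ∘ Fin.suc)

prodExcept : (m : ℕ) → Fin m → (Fin m → ℚ) → ℚ
prodExcept m i f = prodFin m (λ l → g l (l Fin.≟ i))
  where
  g : (l : Fin m) → _ → ℚ
  g l (yes _) = 1ℚ
  g l (no _)  = f l

F : (a m : ℕ) → (Fin m → ℚ) → ℚ → ℚ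
F a m y z = sumFin m (λ i → (y i ^ a) *
  prodExcept m i (λ l → (1ℚ - z * y l) * inv (1ℚ - y l * inv (y i))))

esym : (m : ℕ) → ℕ → (Fin m → ℚ) → ℚ
esym m zero y = 1ℚ
esym zero (suc k) y = 0ℚ
esym (suc m) (suc k) y = esym m (suc k) (y ∘ Fin.suc) + y Fin.zero * esym m k (y ∘ Fin.suc)

-- Polynomials in m variables with coefficients in R: finite lists of
-- monomials (coefficient, exponent vector); repeated exponents are summed.
Poly : Set → ℕ → Set
Poly R m = List (R × Vec ℕ m)

monomial : {m : ℕ} → Vec ℕ m → (Fin m → ℚ) → ℚ
monomial {m} β x = prodFin m (λ i → x i ^ Vec.lookup β i)

evalℚ : {m : ℕ} → Poly ℚ m → (Fin m → ℚ) → ℚ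
evalℚ [] x = 0ℚ
evalℚ ((c , β) ∷ p) x = c * monomial β x + evalℚ p x

evalℤ : {m : ℕ} → Poly ℤ m → (Fin m → ℚ) → ℚ
evalℤ [] x = 0ℚ
evalℤ ((c , β) ∷ p) x = (c Data.Rational./ 1) * monomial β x + evalℤ p x

coeff : {m : ℕ} → Poly ℚ m → Vec ℕ m → ℚ
coeff [] α = 0ℚ
coeff ((c , β) ∷ p) α with ≡-dec ℕ._≟_ β α
... | yes _ = c + coeff p α
... | no _  = coeff p α

totalDeg : {m : ℕ} → Vec ℕ m → ℕ
totalDeg = Vec.foldr _ ℕ._+_ 0

HasDegree : {m : ℕ} → Poly ℚ m → ℕ → Set
HasDegree p d =
  ((α : Vec ℕ _) → coeff p α ≢ 0ℚ → totalDeg α ℕ.≤ d) ×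
  ∃ λ α → totalDeg α ≡ d × coeff p α ≢ 0ℚ

sgn : ℕ → ℚ
sgn j = (- 1ℚ) ^ j

{-# OPTIONS --safe #-}
-- As a function of Z, F_a(Y; Z) is a polynomial of degree < m with F_a(Y; 1/Y_i) = Y_i^a, so it is
-- determined by these m values. With E(Z) = Π_l (1 − Z Y_l) = Σ_k (−1)^k e_k Z^k, the polynomials
-- Q_a(Z) = Σ_j q_{a,j} Z^j given by Q_0 = 1 and Z Q_{a+1}(Z) = Q_a(Z) − q_{a,0} E(Z) take the same
-- values at the 1/Y_i, hence F_a = Q_a. Comparing coefficients,
--   q_{a+1,j} = q_{a,j+1} + (−1)^j e_{j+1} q_{a,0},
-- which exhibits q_{a,j} as an integer polynomial in the e_k, homogeneous of degree a + j in Y.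
-- The degree is exact: at Y = (0, …, 0, 1, 2, …, j+1) one gets q_{a,j} = (−1)^j e_{j+1} h_{a−1},
-- where e_{j+1} = (j+1)! and h_b = q_{b,0} = F_b(Y; 0) is positive by induction on b and m, using
--   F_{b+1}(Y; 0) = Y_1 F_b(Y; 0) + F_{b+1}(Y_2, …, Y_m; 0).

module Submission where

open import Defs
open import Data.Nat using (ℕ; _≤_; _+_)
open import Data.Integer using (ℤ)
open import Data.Rational using (ℚ; 0ℚ; _*_; _-_; -_)
open import Data.Fin using (Fin; toℕ)
open import Data.Product using (Σ; ∃; _×_)
open import Relation.Binary.PropositionalEquality using (_≡_; _≢_)

open import Algebra.Bundles using (CommutativeMonoid)
import Algebra.Properties.Group as GroupProperties
open import Data.Empty using (⊥-elim)
open import Data.Fin as Fin using ()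
import Data.Fin.Properties as FinP
import Data.Integer as ℤ
import Data.Integer.Properties as ℤP
open import Data.List as List using ([]; _∷_; _++_)
open import Data.List.Relation.Unary.All as All using (All; []; _∷_)
import Data.List.Relation.Unary.All.Properties as AllP
open import Data.List.Relation.Unary.Any as Any using (Any; here; there)
open import Data.Nat as ℕ using (zero; suc; s≤s; z≤n; _<_)
import Data.Nat.Coprimality as Coprime
import Data.Nat.Properties as ℕP
open import Data.Product using (_,_; proj₁; proj₂)
import Data.Product as Product
open import Data.Rational as ℚ using (1ℚ; Positive; NonNegative) renaming (_+_ to _⊕_)
import Data.Rational.Properties as ℚP
open import Data.Rational.Solver using (module +-*-Solver)
open import Data.Sum using (inj₁; inj₂)
open import Data.Vec as Vec using (Vec; []; _∷_)
open import Data.Vec.Functional using () renaming (_∷_ to _∷ᶠ_)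
open import Data.Vec.Properties using (≡-dec)
open import Function using (_∘_)
open import Relation.Binary.PropositionalEquality
  using (refl; sym; trans; cong; cong₂; subst; module ≡-Reasoning)
open import Relation.Nullary using (yes; no; Dec; ¬?)

open +-*-Solver using (solve; _:+_; _:*_; _:-_; :-_; con; _:=_)
open import Algebra.Properties.CommutativeSemigroup (CommutativeMonoid.commutativeSemigroup ℚP.+-0-commutativeMonoid)
  using () renaming (interchange to ⊕-interchange)
open import Algebra.Properties.CommutativeSemigroup (CommutativeMonoid.commutativeSemigroup ℚP.*-1-commutativeMonoid)
  using () renaming (interchange to *-interchange)
open import Algebra.Properties.CommutativeSemigroup ℕP.+-commutativeSemigroup
  using () renaming (interchange to ℕ+-interchange)

inv-inverseʳ : ∀ {p} → p ≢ 0ℚ → p * inv p ≡ 1ℚ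
inv-inverseʳ {p} p≢0 with p ℚP.≟ 0ℚ
... | yes p≡0 = ⊥-elim (p≢0 p≡0)
... | no p≢0′ = ℚP.*-inverseʳ p {{ℚ.≢-nonZero p≢0′}}

inv-inverseˡ : ∀ {p} → p ≢ 0ℚ → inv p * p ≡ 1ℚ
inv-inverseˡ {p} p≢0 = trans (ℚP.*-comm (inv p) p) (inv-inverseʳ p≢0)

x*y≡0⇒y≡0 : ∀ {x y} → x ≢ 0ℚ → x * y ≡ 0ℚ → y ≡ 0ℚ
x*y≡0⇒y≡0 {x} {y} x≢0 xy≡0 = begin
  y                ≡⟨ ℚP.*-identityˡ y ⟨
  1ℚ * y           ≡⟨ cong (_* y) (inv-inverseˡ x≢0) ⟨
  (inv x * x) * y  ≡⟨ ℚP.*-assoc (inv x) x y ⟩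
  inv x * (x * y)  ≡⟨ cong (inv x *_) xy≡0 ⟩
  inv x * 0ℚ       ≡⟨ ℚP.*-zeroʳ (inv x) ⟩
  0ℚ               ∎
  where open ≡-Reasoning

*-≢0 : ∀ {x y} → x ≢ 0ℚ → y ≢ 0ℚ → x * y ≢ 0ℚ
*-≢0 x≢0 y≢0 xy≡0 = y≢0 (x*y≡0⇒y≡0 x≢0 xy≡0)

inv-injective : ∀ {p q} → p ≢ 0ℚ → q ≢ 0ℚ → inv p ≡ inv q → p ≡ q
inv-injective {p} {q} p≢0 q≢0 eq = begin
  p                ≡⟨ ℚP.*-identityʳ p ⟨
  p * 1ℚ           ≡⟨ cong (p *_) (inv-inverseˡ q≢0) ⟨
  p * (inv q * q)  ≡⟨ cong (λ t → p * (t * q)) eq ⟨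
  p * (inv p * q)  ≡⟨ ℚP.*-assoc p (inv p) q ⟨
  (p * inv p) * q  ≡⟨ cong (_* q) (inv-inverseʳ p≢0) ⟩
  1ℚ * q           ≡⟨ ℚP.*-identityˡ q ⟩
  q                ∎
  where open ≡-Reasoning

pos⇒≢0 : ∀ {p} → Positive p → p ≢ 0ℚ
pos⇒≢0 {p} p>0 p≡0 = ℚP.<⇒≢ (ℚP.positive⁻¹ p {{p>0}}) (sym p≡0)

x-y≡0⇒x≡y : ∀ {x y} → x - y ≡ 0ℚ → x ≡ y
x-y≡0⇒x≡y {x} {y} = GroupProperties.x∙y⁻¹≈ε⇒x≈y ℚP.+-0-group x y

x-y≡x*[1-y/x] : ∀ {x} y → x ≢ 0ℚ → x - y ≡ x * (1ℚ - y * inv x)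
x-y≡x*[1-y/x] {x} y x≢0 = begin
  x - y                ≡⟨ solve 2 (λ x y → x :- y := x :- y :* con 1ℚ) refl x y ⟩
  x - y * 1ℚ           ≡⟨ cong (λ t → x - y * t) (inv-inverseʳ x≢0) ⟨
  x - y * (x * inv x)  ≡⟨ solve 3 (λ x y i → x :- y :* (x :* i) := x :* (con 1ℚ :- y :* i)) refl x y (inv x) ⟩
  x * (1ℚ - y * inv x) ∎
  where open ≡-Reasoning

1-y/x≢0 : ∀ {x y} → x ≢ 0ℚ → y ≢ x → 1ℚ - y * inv x ≢ 0ℚ
1-y/x≢0 {x} {y} x≢0 y≢x eq =
  y≢x (sym (x-y≡0⇒x≡y (trans (x-y≡x*[1-y/x] y x≢0) (trans (cong (x *_) eq) (ℚP.*-zeroʳ x)))))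

[x-y]*[1-y/x]⁻¹≡x : ∀ {x y} → x ≢ 0ℚ → y ≢ x → (x - y) * inv (1ℚ - y * inv x) ≡ x
[x-y]*[1-y/x]⁻¹≡x {x} {y} x≢0 y≢x = begin
  (x - y) * inv w        ≡⟨ cong (_* inv w) (x-y≡x*[1-y/x] y x≢0) ⟩
  (x * w) * inv w        ≡⟨ ℚP.*-assoc x w (inv w) ⟩
  x * (w * inv w)        ≡⟨ cong (x *_) (inv-inverseʳ (1-y/x≢0 x≢0 y≢x)) ⟩
  x * 1ℚ                 ≡⟨ ℚP.*-identityʳ x ⟩
  x                      ∎
  where
  open ≡-Reasoning
  w = 1ℚ - y * inv x

1-x⁻¹*x≡0 : ∀ {x} → x ≢ 0ℚ → 1ℚ - inv x * x ≡ 0ℚ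
1-x⁻¹*x≡0 x≢0 = trans (cong (λ t → 1ℚ - t) (inv-inverseˡ x≢0)) (ℚP.+-inverseʳ 1ℚ)

sumFin-cong : ∀ n {f g : Fin n → ℚ} → (∀ i → f i ≡ g i) → sumFin n f ≡ sumFin n g
sumFin-cong zero    f≗g = refl
sumFin-cong (suc n) f≗g = cong₂ _⊕_ (f≗g Fin.zero) (sumFin-cong n (f≗g ∘ Fin.suc))

sumFin-+ : ∀ n (f g : Fin n → ℚ) → sumFin n (λ i → f i ⊕ g i) ≡ sumFin n f ⊕ sumFin n g
sumFin-+ zero    f g = sym (ℚP.+-identityˡ 0ℚ)
sumFin-+ (suc n) f g = trans (cong (f Fin.zero ⊕ g Fin.zero ⊕_) (sumFin-+ n (f ∘ Fin.suc) (g ∘ Fin.suc)))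
  (⊕-interchange (f Fin.zero) (g Fin.zero) (sumFin n (f ∘ Fin.suc)) (sumFin n (g ∘ Fin.suc)))

*-distribˡ-sumFin : ∀ n a (f : Fin n → ℚ) → a * sumFin n f ≡ sumFin n (λ i → a * f i)
*-distribˡ-sumFin zero    a f = ℚP.*-zeroʳ a
*-distribˡ-sumFin (suc n) a f = trans (ℚP.*-distribˡ-+ a (f Fin.zero) _)
  (cong (a * f Fin.zero ⊕_) (*-distribˡ-sumFin n a (f ∘ Fin.suc)))

sumFin-0 : ∀ n {f : Fin n → ℚ} → (∀ i → f i ≡ 0ℚ) → sumFin n f ≡ 0ℚ
sumFin-0 zero    f≗0 = refl
sumFin-0 (suc n) f≗0 = trans (cong₂ _⊕_ (f≗0 Fin.zero) (sumFin-0 n (f≗0 ∘ Fin.suc))) (ℚP.+-identityˡ 0ℚ)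

sumFin-single : ∀ n {f : Fin n → ℚ} i₀ → (∀ i → i ≢ i₀ → f i ≡ 0ℚ) → sumFin n f ≡ f i₀
sumFin-single (suc n) {f} Fin.zero f≡0 =
  trans (cong (f Fin.zero ⊕_) (sumFin-0 n (λ i → f≡0 (Fin.suc i) λ ()))) (ℚP.+-identityʳ _)
sumFin-single (suc n) (Fin.suc i₀) f≡0 =
  trans (cong₂ _⊕_ (f≡0 Fin.zero λ ())
                   (sumFin-single n i₀ (λ i i≢i₀ → f≡0 (Fin.suc i) (i≢i₀ ∘ FinP.suc-injective))))
    (ℚP.+-identityˡ _)

prodFin-cong : ∀ n {f g : Fin n → ℚ} → (∀ i → f i ≡ g i) → prodFin n f ≡ prodFin n g
prodFin-cong zero    f≗g = refl
prodFin-cong (suc n) f≗g = cong₂ _*_ (f≗g Fin.zero) (prodFin-cong n (f≗g ∘ Fin.suc))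

prodFin-0 : ∀ n {f : Fin n → ℚ} i → f i ≡ 0ℚ → prodFin n f ≡ 0ℚ
prodFin-0 (suc n) {f} Fin.zero    fi≡0 =
  trans (cong (_* prodFin n (f ∘ Fin.suc)) fi≡0) (ℚP.*-zeroˡ (prodFin n (f ∘ Fin.suc)))
prodFin-0 (suc n) {f} (Fin.suc i) fi≡0 = trans (cong (f Fin.zero *_) (prodFin-0 n i fi≡0)) (ℚP.*-zeroʳ (f Fin.zero))

prodFin-1 : ∀ n {f : Fin n → ℚ} → (∀ i → f i ≡ 1ℚ) → prodFin n f ≡ 1ℚ
prodFin-1 zero    f≗1 = refl
prodFin-1 (suc n) f≗1 = trans (cong₂ _*_ (f≗1 Fin.zero) (prodFin-1 n (f≗1 ∘ Fin.suc))) (ℚP.*-identityˡ 1ℚ)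

prodFin-≢0 : ∀ n {f : Fin n → ℚ} → (∀ i → f i ≢ 0ℚ) → prodFin n f ≢ 0ℚ
prodFin-≢0 zero    f≢0 = ℚP.1≢0
prodFin-≢0 (suc n) f≢0 = *-≢0 (f≢0 Fin.zero) (prodFin-≢0 n (f≢0 ∘ Fin.suc))

omit : ∀ {m} → Fin m → (Fin m → ℚ) → Fin m → ℚ
omit i f l with l Fin.≟ i
... | yes _ = 1ℚ
... | no  _ = f l

-- The factor function of prodExcept is local to Defs; unification recovers it from omit.
mutual
  prodExcept-omit : ∀ m i f → prodExcept m i f ≡ prodFin m (omit i f)
  prodExcept-omit m i f = prodFin-cong m (prodExcept-factor m i f)

  private
    prodExcept-factor : ∀ m i f (l : Fin m) → _ ≡ omit i f l
    prodExcept-factor m i f l with l Fin.≟ i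
    ... | yes _ = refl
    ... | no  _ = refl

omit-≡ : ∀ {m} (i l : Fin m) f → l ≡ i → omit i f l ≡ 1ℚ
omit-≡ i l f l≡i with l Fin.≟ i
... | yes _   = refl
... | no  l≢i = ⊥-elim (l≢i l≡i)

omit-≢ : ∀ {m} (i l : Fin m) f → l ≢ i → omit i f l ≡ f l
omit-≢ i l f l≢i with l Fin.≟ i
... | yes l≡i = ⊥-elim (l≢i l≡i)
... | no  _   = refl

omit-suc : ∀ {m} (i l : Fin m) f → omit (Fin.suc i) f (Fin.suc l) ≡ omit i (f ∘ Fin.suc) l
omit-suc i l f = by-cases (l Fin.≟ i)
  where
  by-cases : Dec (l ≡ i) → omit (Fin.suc i) f (Fin.suc l) ≡ omit i (f ∘ Fin.suc) l
  by-cases (yes l≡i) = trans (omit-≡ (Fin.suc i) (Fin.suc l) f (cong Fin.suc l≡i))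
                             (sym (omit-≡ i l (f ∘ Fin.suc) l≡i))
  by-cases (no  l≢i) = trans (omit-≢ (Fin.suc i) (Fin.suc l) f (l≢i ∘ FinP.suc-injective))
                             (sym (omit-≢ i l (f ∘ Fin.suc) l≢i))

prodExcept-zero : ∀ m f → prodExcept (suc m) Fin.zero f ≡ prodFin m (f ∘ Fin.suc)
prodExcept-zero m f = begin
  prodExcept (suc m) Fin.zero f               ≡⟨ prodExcept-omit (suc m) Fin.zero f ⟩
  1ℚ * prodFin m (omit Fin.zero f ∘ Fin.suc)  ≡⟨ ℚP.*-identityˡ (prodFin m (omit Fin.zero f ∘ Fin.suc)) ⟩
  prodFin m (omit Fin.zero f ∘ Fin.suc)       ≡⟨ prodFin-cong m (λ l → omit-≢ Fin.zero (Fin.suc l) f λ ()) ⟩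
  prodFin m (f ∘ Fin.suc)                     ∎
  where open ≡-Reasoning

prodExcept-suc : ∀ m i f → prodExcept (suc m) (Fin.suc i) f ≡ f Fin.zero * prodExcept m i (f ∘ Fin.suc)
prodExcept-suc m i f = begin
  prodExcept (suc m) (Fin.suc i) f                                ≡⟨ prodExcept-omit (suc m) (Fin.suc i) f ⟩
  omit (Fin.suc i) f Fin.zero * prodFin m (omit (Fin.suc i) f ∘ Fin.suc)
    ≡⟨ cong₂ _*_ (omit-≢ (Fin.suc i) Fin.zero f λ ()) (prodFin-cong m (λ l → omit-suc i l f)) ⟩
  f Fin.zero * prodFin m (omit i (f ∘ Fin.suc))
    ≡⟨ cong (f Fin.zero *_) (prodExcept-omit m i (f ∘ Fin.suc)) ⟨
  f Fin.zero * prodExcept m i (f ∘ Fin.suc)                       ∎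
  where open ≡-Reasoning

prodExcept-0 : ∀ m {i : Fin m} l f → l ≢ i → f l ≡ 0ℚ → prodExcept m i f ≡ 0ℚ
prodExcept-0 m {i} l f l≢i fl≡0 = trans (prodExcept-omit m i f) (prodFin-0 m l (trans (omit-≢ i l f l≢i) fl≡0))

prodExcept-1 : ∀ m {i : Fin m} f → (∀ l → l ≢ i → f l ≡ 1ℚ) → prodExcept m i f ≡ 1ℚ
prodExcept-1 m {i} f f≡1 = trans (prodExcept-omit m i f) (prodFin-1 m omit≡1)
  where
  omit≡1 : ∀ l → omit i f l ≡ 1ℚ
  omit≡1 l = by-cases (l Fin.≟ i)
    where
    by-cases : Dec (l ≡ i) → omit i f l ≡ 1ℚ
    by-cases (yes l≡i) = omit-≡ i l f l≡i
    by-cases (no  l≢i) = trans (omit-≢ i l f l≢i) (f≡1 l l≢i)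

Distinct : ∀ {n} → (Fin n → ℚ) → Set
Distinct y = ∀ i l → i ≢ l → y i ≢ y l

AllNonzero : ∀ {n} → (Fin n → ℚ) → Set
AllNonzero y = ∀ i → y i ≢ 0ℚ

AllPositive : ∀ {n} → (Fin n → ℚ) → Set
AllPositive y = ∀ i → Positive (y i)

Distinct-tail : ∀ {n} {y : Fin (suc n) → ℚ} → Distinct y → Distinct (y ∘ Fin.suc)
Distinct-tail dist i l i≢l = dist (Fin.suc i) (Fin.suc l) (i≢l ∘ FinP.suc-injective)

-- Polynomials in one variable

evalPoly : ℕ → (ℕ → ℚ) → ℚ → ℚ
evalPoly n c z = sumFin n (λ k → c (toℕ k) * z ^ toℕ k)

evalPoly-horner : ∀ n c z → evalPoly (suc n) c z ≡ c 0 ⊕ z * evalPoly n (c ∘ suc) z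
evalPoly-horner n c z = cong₂ _⊕_ (ℚP.*-identityʳ (c 0)) (begin
  sumFin n (λ k → c (suc (toℕ k)) * (z * z ^ toℕ k))  ≡⟨ sumFin-cong n (λ k → reorder (c (suc (toℕ k))) (z ^ toℕ k)) ⟩
  sumFin n (λ k → z * (c (suc (toℕ k)) * z ^ toℕ k))  ≡⟨ *-distribˡ-sumFin n z _ ⟨
  z * evalPoly n (c ∘ suc) z                          ∎)
  where
  open ≡-Reasoning
  reorder : ∀ a t → a * (z * t) ≡ z * (a * t)
  reorder a t = solve 3 (λ a z t → a :* (z :* t) := z :* (a :* t)) refl a z t

evalPoly-cong : ∀ n {c d : ℕ → ℚ} → (∀ k → c k ≡ d k) → ∀ z → evalPoly n c z ≡ evalPoly n d z
evalPoly-cong n c≗d z = sumFin-cong n (λ k → cong (_* z ^ toℕ k) (c≗d (toℕ k)))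

evalPoly-+ : ∀ n c d z → evalPoly n (λ k → c k ⊕ d k) z ≡ evalPoly n c z ⊕ evalPoly n d z
evalPoly-+ n c d z = trans (sumFin-cong n (λ k → ℚP.*-distribʳ-+ (z ^ toℕ k) (c (toℕ k)) (d (toℕ k)))) (sumFin-+ n _ _)

evalPoly-scale : ∀ n a c z → evalPoly n (λ k → a * c k) z ≡ a * evalPoly n c z
evalPoly-scale n a c z =
  trans (sumFin-cong n (λ k → ℚP.*-assoc a (c (toℕ k)) (z ^ toℕ k))) (sym (*-distribˡ-sumFin n a _))

evalPoly-0 : ∀ n z → evalPoly n (λ _ → 0ℚ) z ≡ 0ℚ
evalPoly-0 n z = sumFin-0 n (λ k → ℚP.*-zeroˡ (z ^ toℕ k))

evalPoly-at-0 : ∀ n c → evalPoly (suc n) c 0ℚ ≡ c 0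
evalPoly-at-0 n c = trans (evalPoly-horner n c 0ℚ)
  (trans (cong (c 0 ⊕_) (ℚP.*-zeroˡ (evalPoly n (c ∘ suc) 0ℚ))) (ℚP.+-identityʳ (c 0)))

evalPoly-dropTop : ∀ n c → c n ≡ 0ℚ → ∀ z → evalPoly (suc n) c z ≡ evalPoly n c z
evalPoly-dropTop zero    c c0≡0 z = trans (cong (λ t → t * 1ℚ ⊕ 0ℚ) c0≡0) refl
evalPoly-dropTop (suc n) c cn≡0 z = begin
  evalPoly (suc (suc n)) c z                ≡⟨ evalPoly-horner (suc n) c z ⟩
  c 0 ⊕ z * evalPoly (suc n) (c ∘ suc) z    ≡⟨ cong (λ t → c 0 ⊕ z * t) (evalPoly-dropTop n (c ∘ suc) cn≡0 z) ⟩
  c 0 ⊕ z * evalPoly n (c ∘ suc) z          ≡⟨ evalPoly-horner n c z ⟨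
  evalPoly (suc n) c z                      ∎
  where open ≡-Reasoning

shift : (ℕ → ℚ) → ℕ → ℚ
shift c zero    = 0ℚ
shift c (suc k) = c k

evalPoly-shift : ∀ n c z → evalPoly (suc n) (shift c) z ≡ z * evalPoly n c z
evalPoly-shift n c z = trans (evalPoly-horner n (shift c) z) (ℚP.+-identityˡ _)

truncate : ℕ → (ℕ → ℚ) → ℕ → ℚ
truncate zero    c _       = 0ℚ
truncate (suc n) c zero    = c 0
truncate (suc n) c (suc k) = truncate n (c ∘ suc) k

evalPoly-truncate : ∀ n c z → evalPoly (suc n) (truncate n c) z ≡ evalPoly n c z
evalPoly-truncate zero    c z = evalPoly-dropTop zero (λ _ → 0ℚ) refl z
evalPoly-truncate (suc n) c z = begin
  evalPoly (suc (suc n)) (truncate (suc n) c) z                  ≡⟨ evalPoly-horner (suc n) (truncate (suc n) c) z ⟩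
  c 0 ⊕ z * evalPoly (suc n) (truncate n (c ∘ suc)) z            ≡⟨ cong (λ t → c 0 ⊕ z * t) (evalPoly-truncate n (c ∘ suc) z) ⟩
  c 0 ⊕ z * evalPoly n (c ∘ suc) z                               ≡⟨ evalPoly-horner n c z ⟨
  evalPoly (suc n) c z                                           ∎
  where open ≡-Reasoning

record IsPoly< (n : ℕ) (f : ℚ → ℚ) : Set where
  constructor _,_
  field
    coeffs     : ℕ → ℚ
    evalCoeffs : ∀ z → f z ≡ evalPoly n coeffs z

IsPoly<-cong : ∀ {n f g} → (∀ z → f z ≡ g z) → IsPoly< n f → IsPoly< n g
IsPoly<-cong f≗g (c , f≗c) = c , λ z → trans (sym (f≗g z)) (f≗c z)

IsPoly<-0 : ∀ n → IsPoly< n (λ _ → 0ℚ)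
IsPoly<-0 n = (λ _ → 0ℚ) , λ z → sym (evalPoly-0 n z)

IsPoly<-const : ∀ a → IsPoly< 1 (λ _ → a)
IsPoly<-const a = (λ _ → a) , λ z → sym (trans (ℚP.+-identityʳ _) (ℚP.*-identityʳ a))

IsPoly<-+ : ∀ {n f g} → IsPoly< n f → IsPoly< n g → IsPoly< n (λ z → f z ⊕ g z)
IsPoly<-+ {n} (c , f≗c) (d , g≗d) =
  (λ k → c k ⊕ d k) , λ z → trans (cong₂ _⊕_ (f≗c z) (g≗d z)) (sym (evalPoly-+ n c d z))

IsPoly<-scale : ∀ {n f} a → IsPoly< n f → IsPoly< n (λ z → a * f z)
IsPoly<-scale {n} a (c , f≗c) = (λ k → a * c k) , λ z → trans (cong (a *_) (f≗c z)) (sym (evalPoly-scale n a c z))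

IsPoly<-suc : ∀ {n f} → IsPoly< n f → IsPoly< (suc n) f
IsPoly<-suc {n} (c , f≗c) = truncate n c , λ z → trans (f≗c z) (sym (evalPoly-truncate n c z))

IsPoly<-shift : ∀ {n f} → IsPoly< n f → IsPoly< (suc n) (λ z → z * f z)
IsPoly<-shift {n} (c , f≗c) = shift c , λ z → trans (cong (z *_) (f≗c z)) (sym (evalPoly-shift n c z))

IsPoly<-linear* : ∀ {n f} α β → IsPoly< n f → IsPoly< (suc n) (λ z → (α ⊕ β * z) * f z)
IsPoly<-linear* {f = f} α β f-poly =
  IsPoly<-cong expand (IsPoly<-+ (IsPoly<-suc (IsPoly<-scale α f-poly)) (IsPoly<-scale β (IsPoly<-shift f-poly)))
  where
  expand : ∀ z → α * f z ⊕ β * (z * f z) ≡ (α ⊕ β * z) * f z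
  expand z = solve 4 (λ α β z t → α :* t :+ β :* (z :* t) := (α :+ β :* z) :* t) refl α β z (f z)

IsPoly<-sumFin : ∀ {n} m (f : Fin m → ℚ → ℚ) → (∀ i → IsPoly< n (f i)) → IsPoly< n (λ z → sumFin m (λ i → f i z))
IsPoly<-sumFin {n} zero    f f-poly = IsPoly<-0 n
IsPoly<-sumFin     (suc m) f f-poly = IsPoly<-+ (f-poly Fin.zero) (IsPoly<-sumFin m (f ∘ Fin.suc) (f-poly ∘ Fin.suc))

evalPoly-factor : ∀ n c p → Σ (ℕ → ℚ) λ d →
  ∀ z → evalPoly (suc n) c z ≡ evalPoly (suc n) c p ⊕ (z - p) * evalPoly n d z
evalPoly-factor zero c p = (λ _ → 0ℚ) , λ z →
  solve 3 (λ c z p → c :* con 1ℚ :+ con 0ℚ := (c :* con 1ℚ :+ con 0ℚ) :+ (z :- p) :* con 0ℚ) refl (c 0) z p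
evalPoly-factor (suc n) c p = shift-quotient , λ z → begin
  evalPoly (suc (suc n)) c z             ≡⟨ evalPoly-horner (suc n) c z ⟩
  c 0 ⊕ z * evalPoly (suc n) (c ∘ suc) z ≡⟨ cong (λ t → c 0 ⊕ z * t) (proj₂ tail-factor z) ⟩
  c 0 ⊕ z * (r ⊕ (z - p) * d z)          ≡⟨ regroup (c 0) z p r (d z) ⟩
  (c 0 ⊕ p * r) ⊕ (z - p) * (r ⊕ z * d z)
    ≡⟨ cong₂ (λ s t → s ⊕ (z - p) * t) (evalPoly-horner (suc n) c p) (evalPoly-horner n shift-quotient z) ⟨
  evalPoly (suc (suc n)) c p ⊕ (z - p) * evalPoly (suc n) shift-quotient z ∎
  where
  open ≡-Reasoning
  tail-factor = evalPoly-factor n (c ∘ suc) p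
  r = evalPoly (suc n) (c ∘ suc) p
  d = evalPoly n (proj₁ tail-factor)
  shift-quotient : ℕ → ℚ
  shift-quotient zero    = r
  shift-quotient (suc k) = proj₁ tail-factor k
  regroup : ∀ c₀ z p r d → c₀ ⊕ z * (r ⊕ (z - p) * d) ≡ (c₀ ⊕ p * r) ⊕ (z - p) * (r ⊕ z * d)
  regroup = solve 5 (λ c₀ z p r d → c₀ :+ z :* (r :+ (z :- p) :* d) := (c₀ :+ p :* r) :+ (z :- p) :* (r :+ z :* d)) refl

IsPoly<-factor : ∀ {n f} → IsPoly< (suc n) f → ∀ p →
  Σ (ℚ → ℚ) λ g → IsPoly< n g × (∀ z → f z ≡ f p ⊕ (z - p) * g z)
IsPoly<-factor {n} (c , f≗c) p with evalPoly-factor n c p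
... | d , factored = evalPoly n d , (d , λ _ → refl) ,
  λ z → trans (f≗c z) (trans (factored z) (cong (_⊕ (z - p) * evalPoly n d z) (sym (f≗c p))))

IsPoly<-roots⇒0 : ∀ {n f} → IsPoly< n f → (pts : Fin n → ℚ) → Distinct pts →
  (∀ i → f (pts i) ≡ 0ℚ) → ∀ z → f z ≡ 0ℚ
IsPoly<-roots⇒0 {zero}  (c , f≗c) pts dist roots z = f≗c z
IsPoly<-roots⇒0 {suc n} {f} f-poly pts dist roots z with IsPoly<-factor f-poly (pts Fin.zero)
... | g , g-poly , factored = trans (f≡[z-p₀]g z) (trans (cong ((z - p₀) *_) g≡0) (ℚP.*-zeroʳ (z - p₀)))
  where
  p₀ = pts Fin.zero
  f≡[z-p₀]g : ∀ z → f z ≡ (z - p₀) * g z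
  f≡[z-p₀]g z = trans (factored z) (trans (cong (_⊕ (z - p₀) * g z) (roots Fin.zero)) (ℚP.+-identityˡ _))
  g-roots : ∀ i → g (pts (Fin.suc i)) ≡ 0ℚ
  g-roots i = x*y≡0⇒y≡0 (λ eq → dist (Fin.suc i) Fin.zero (λ ()) (x-y≡0⇒x≡y eq))
                         (trans (sym (f≡[z-p₀]g (pts (Fin.suc i)))) (roots (Fin.suc i)))
  g≡0 = IsPoly<-roots⇒0 g-poly (pts ∘ Fin.suc) (Distinct-tail dist) g-roots z

IsPoly<-agree : ∀ {n f g} → IsPoly< n f → IsPoly< n g → (pts : Fin n → ℚ) → Distinct pts →
  (∀ i → f (pts i) ≡ g (pts i)) → ∀ z → f z ≡ g z
IsPoly<-agree {f = f} {g} f-poly g-poly pts dist agree z =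
  x-y≡0⇒x≡y (IsPoly<-roots⇒0 difference pts dist roots z)
  where
  roots : ∀ i → f (pts i) - g (pts i) ≡ 0ℚ
  roots i = trans (cong (_- g (pts i)) (agree i)) (ℚP.+-inverseʳ (g (pts i)))
  difference : IsPoly< _ (λ z → f z - g z)
  difference = IsPoly<-cong (λ z → solve 2 (λ a b → a :+ con (- 1ℚ) :* b := a :- b) refl (f z) (g z))
                            (IsPoly<-+ f-poly (IsPoly<-scale (- 1ℚ) g-poly))

IsPoly<-prodFin : ∀ n (f : Fin n → ℚ → ℚ) (α β : Fin n → ℚ) → (∀ l z → f l z ≡ α l ⊕ β l * z) →
  IsPoly< (suc n) (λ z → prodFin n (λ l → f l z))
IsPoly<-prodFin zero    f α β f-linear = IsPoly<-const 1ℚ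
IsPoly<-prodFin (suc n) f α β f-linear =
  IsPoly<-cong (λ z → cong (_* prodFin n (λ l → f (Fin.suc l) z)) (sym (f-linear Fin.zero z)))
    (IsPoly<-linear* (α Fin.zero) (β Fin.zero)
      (IsPoly<-prodFin n (f ∘ Fin.suc) (α ∘ Fin.suc) (β ∘ Fin.suc) (f-linear ∘ Fin.suc)))

IsPoly<-prodExcept : ∀ m i (f : Fin m → ℚ → ℚ) (α β : Fin m → ℚ) → (∀ l z → f l z ≡ α l ⊕ β l * z) →
  IsPoly< m (λ z → prodExcept m i (λ l → f l z))
IsPoly<-prodExcept (suc m) Fin.zero f α β f-linear =
  IsPoly<-cong (λ z → sym (prodExcept-zero m (λ l → f l z)))
    (IsPoly<-prodFin m (f ∘ Fin.suc) (α ∘ Fin.suc) (β ∘ Fin.suc) (f-linear ∘ Fin.suc))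
IsPoly<-prodExcept (suc m) (Fin.suc i) f α β f-linear =
  IsPoly<-cong (λ z → trans (cong (_* prodExcept m i (λ l → f (Fin.suc l) z)) (sym (f-linear Fin.zero z)))
                            (sym (prodExcept-suc m i (λ l → f l z))))
    (IsPoly<-linear* (α Fin.zero) (β Fin.zero)
      (IsPoly<-prodExcept m i (f ∘ Fin.suc) (α ∘ Fin.suc) (β ∘ Fin.suc) (f-linear ∘ Fin.suc)))

-- F as a polynomial in Z

F-factor : ∀ {m} → (Fin m → ℚ) → ℚ → Fin m → Fin m → ℚ
F-factor y z i l = (1ℚ - z * y l) * inv (1ℚ - y l * inv (y i))

F-isPoly< : ∀ a m y → IsPoly< m (F a m y)
F-isPoly< a m y = IsPoly<-sumFin m _ λ i → IsPoly<-scale (y i ^ a)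
  (IsPoly<-prodExcept m i (λ l z → F-factor y z i l) (K i) (λ l → - y l * K i l) (λ l z → linear (y l) (K i l) z))
  where
  K : Fin m → Fin m → ℚ
  K i l = inv (1ℚ - y l * inv (y i))
  linear : ∀ w k z → (1ℚ - z * w) * k ≡ k ⊕ (- w * k) * z
  linear = solve 3 (λ w k z → (con 1ℚ :- z :* w) :* k := k :+ (:- w :* k) :* z) refl

F-at-inv : ∀ a m y → AllNonzero y → Distinct y → ∀ i₀ → F a m y (inv (y i₀)) ≡ y i₀ ^ a
F-at-inv a m y y≢0 dist i₀ =
  trans (sumFin-single m i₀ other-terms) (trans (cong (y i₀ ^ a *_) own-factors) (ℚP.*-identityʳ _))
  where
  z = inv (y i₀)
  factor = F-factor y z
  other-terms : ∀ i → i ≢ i₀ → y i ^ a * prodExcept m i (factor i) ≡ 0ℚ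
  other-terms i i≢i₀ = trans (cong (y i ^ a *_) (prodExcept-0 m i₀ (factor i) (i≢i₀ ∘ sym) vanishes))
                             (ℚP.*-zeroʳ (y i ^ a))
    where
    vanishes : factor i i₀ ≡ 0ℚ
    vanishes = trans (cong (_* inv (1ℚ - y i₀ * inv (y i))) (1-x⁻¹*x≡0 (y≢0 i₀)))
                     (ℚP.*-zeroˡ (inv (1ℚ - y i₀ * inv (y i))))
  own-factors : prodExcept m i₀ (factor i₀) ≡ 1ℚ
  own-factors = prodExcept-1 m (factor i₀) λ l l≢i₀ →
    trans (cong (λ t → (1ℚ - t) * inv (1ℚ - y l * z)) (ℚP.*-comm z (y l)))
          (inv-inverseʳ (1-y/x≢0 (y≢0 i₀) (dist l i₀ l≢i₀)))

F-cons : ∀ b m y z → AllNonzero y → Distinct y →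
  F (suc b) (suc m) y z ≡ y Fin.zero * F b (suc m) y z ⊕ (1ℚ - z * y Fin.zero) * F (suc b) m (y ∘ Fin.suc) z
F-cons b m y z y≢0 dist = begin
  y₀ * y₀ ^ b * P Fin.zero ⊕ sumFin m (λ i → u i * u i ^ b * P (Fin.suc i))
    ≡⟨ cong₂ _⊕_ (ℚP.*-assoc y₀ (y₀ ^ b) (P Fin.zero)) (sumFin-cong m split-term) ⟩
  y₀ * (y₀ ^ b * P Fin.zero) ⊕ sumFin m (λ i → y₀ * (u i ^ b * P (Fin.suc i)) ⊕ c * (u i * u i ^ b * P′ i))
    ≡⟨ cong (y₀ * (y₀ ^ b * P Fin.zero) ⊕_) (trans (sumFin-+ m _ _)
         (sym (cong₂ _⊕_ (*-distribˡ-sumFin m y₀ _) (*-distribˡ-sumFin m c _)))) ⟩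
  y₀ * (y₀ ^ b * P Fin.zero) ⊕ (y₀ * Σ₀ ⊕ c * Σ′)
    ≡⟨ solve 5 (λ y₀ t Σ₀ c Σ′ → y₀ :* t :+ (y₀ :* Σ₀ :+ c :* Σ′) := y₀ :* (t :+ Σ₀) :+ c :* Σ′) refl
         y₀ (y₀ ^ b * P Fin.zero) Σ₀ c Σ′ ⟩
  y₀ * (y₀ ^ b * P Fin.zero ⊕ Σ₀) ⊕ c * Σ′ ∎
  where
  open ≡-Reasoning
  y₀ = y Fin.zero
  u = y ∘ Fin.suc
  c = 1ℚ - z * y₀
  factor = F-factor y z
  P : Fin (suc m) → ℚ
  P i = prodExcept (suc m) i (factor i)
  P′ : Fin m → ℚ
  P′ i = prodExcept m i (factor (Fin.suc i) ∘ Fin.suc)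
  Σ₀ = sumFin m (λ i → u i ^ b * P (Fin.suc i))
  Σ′ = sumFin m (λ i → u i * u i ^ b * P′ i)
  split-term : ∀ i → u i * u i ^ b * P (Fin.suc i) ≡ y₀ * (u i ^ b * P (Fin.suc i)) ⊕ c * (u i * u i ^ b * P′ i)
  split-term i = begin
    u i * uᵇ * P (Fin.suc i)                                  ≡⟨ cong (u i * uᵇ *_) P≡ ⟩
    u i * uᵇ * (c * k * P′ i)                                 ≡⟨ regroup (u i) uᵇ y₀ c k (P′ i) ⟩
    y₀ * (uᵇ * (c * k * P′ i)) ⊕ uᵇ * c * P′ i * ((u i - y₀) * k)
      ≡⟨ cong (λ t → y₀ * (uᵇ * (c * k * P′ i)) ⊕ uᵇ * c * P′ i * t)
              ([x-y]*[1-y/x]⁻¹≡x (y≢0 (Fin.suc i)) (dist Fin.zero (Fin.suc i) λ ())) ⟩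
    y₀ * (uᵇ * (c * k * P′ i)) ⊕ uᵇ * c * P′ i * u i
      ≡⟨ cong₂ _⊕_ (cong (λ t → y₀ * (uᵇ * t)) (sym P≡))
                   (solve 4 (λ uᵇ c p u → uᵇ :* c :* p :* u := c :* (u :* uᵇ :* p)) refl uᵇ c (P′ i) (u i)) ⟩
    y₀ * (uᵇ * P (Fin.suc i)) ⊕ c * (u i * uᵇ * P′ i)       ∎
    where
    uᵇ = u i ^ b
    k = inv (1ℚ - y₀ * inv (u i))
    P≡ : P (Fin.suc i) ≡ c * k * P′ i
    P≡ = prodExcept-suc m i (factor (Fin.suc i))
    regroup : ∀ u uᵇ y₀ c k p → u * uᵇ * (c * k * p) ≡ y₀ * (uᵇ * (c * k * p)) ⊕ uᵇ * c * p * ((u - y₀) * k)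
    regroup = solve 6 (λ u uᵇ y₀ c k p → u :* uᵇ :* (c :* k :* p)
                        := y₀ :* (uᵇ :* (c :* k :* p)) :+ uᵇ :* c :* p :* ((u :- y₀) :* k)) refl

-- The expansion F_a = Σ_j q_{a,j} Z^j

esyms : (m : ℕ) → (Fin m → ℚ) → ℕ → ℚ
esyms m y k = esym m k y

esym-vanish : ∀ m k y → m < k → esym m k y ≡ 0ℚ
esym-vanish zero    (suc k) y m<k       = refl
esym-vanish (suc m) (suc k) y (s≤s m<k) = begin
  esym m (suc k) (y ∘ Fin.suc) ⊕ y Fin.zero * esym m k (y ∘ Fin.suc)
    ≡⟨ cong₂ (λ s t → s ⊕ y Fin.zero * t) (esym-vanish m (suc k) (y ∘ Fin.suc) (ℕP.m<n⇒m<1+n m<k))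
                                           (esym-vanish m k (y ∘ Fin.suc) m<k) ⟩
  0ℚ ⊕ y Fin.zero * 0ℚ ≡⟨ solve 1 (λ y → con 0ℚ :+ y :* con 0ℚ := con 0ℚ) refl (y Fin.zero) ⟩
  0ℚ                   ∎
  where open ≡-Reasoning

esym-top : ∀ m y → esym m m y ≡ prodFin m y
esym-top zero    y = refl
esym-top (suc m) y = trans (cong₂ _⊕_ (esym-vanish m (suc m) (y ∘ Fin.suc) (ℕP.n<1+n m))
                                      (cong (y Fin.zero *_) (esym-top m (y ∘ Fin.suc))))
                           (ℚP.+-identityˡ _)

esym-cons0 : ∀ m k y → esym (suc m) k (0ℚ ∷ᶠ y) ≡ esym m k y
esym-cons0 m zero    y = refl
esym-cons0 m (suc k) y = trans (cong (esym m (suc k) y ⊕_) (ℚP.*-zeroˡ (esym m k y))) (ℚP.+-identityʳ _)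

signed : (ℕ → ℚ) → ℕ → ℚ
signed e k = sgn k * e k

evalPoly-signed-esyms : ∀ m y z → evalPoly (suc m) (signed (esyms m y)) z ≡ prodFin m (λ l → 1ℚ - z * y l)
evalPoly-signed-esyms zero    y z = refl
evalPoly-signed-esyms (suc m) y z = begin
  evalPoly (suc (suc m)) (signed (esyms (suc m) y)) z
    ≡⟨ evalPoly-cong (suc (suc m)) split z ⟩
  evalPoly (suc (suc m)) (λ k → a k ⊕ shift (λ k → - y₀ * a k) k) z
    ≡⟨ evalPoly-+ (suc (suc m)) a (shift (λ k → - y₀ * a k)) z ⟩
  evalPoly (suc (suc m)) a z ⊕ evalPoly (suc (suc m)) (shift (λ k → - y₀ * a k)) z
    ≡⟨ cong₂ _⊕_ (evalPoly-dropTop (suc m) a a-top≡0 z)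
                 (trans (evalPoly-shift (suc m) (λ k → - y₀ * a k) z)
                        (cong (z *_) (evalPoly-scale (suc m) (- y₀) a z))) ⟩
  A ⊕ z * (- y₀ * A)  ≡⟨ solve 3 (λ A z y₀ → A :+ z :* (:- y₀ :* A) := (con 1ℚ :- z :* y₀) :* A) refl A z y₀ ⟩
  (1ℚ - z * y₀) * A   ≡⟨ cong ((1ℚ - z * y₀) *_) (evalPoly-signed-esyms m (y ∘ Fin.suc) z) ⟩
  prodFin (suc m) (λ l → 1ℚ - z * y l) ∎
  where
  open ≡-Reasoning
  y₀ = y Fin.zero
  a = signed (esyms m (y ∘ Fin.suc))
  A = evalPoly (suc m) a z
  a-top≡0 : a (suc m) ≡ 0ℚ
  a-top≡0 = trans (cong (sgn (suc m) *_) (esym-vanish m (suc m) (y ∘ Fin.suc) (ℕP.n<1+n m))) (ℚP.*-zeroʳ (sgn (suc m)))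
  split : ∀ k → signed (esyms (suc m) y) k ≡ a k ⊕ shift (λ k → - y₀ * a k) k
  split zero    = sym (ℚP.+-identityʳ _)
  split (suc k) = solve 4 (λ s e e′ y₀ → con (- 1ℚ) :* s :* (e :+ y₀ :* e′)
                                       := con (- 1ℚ) :* s :* e :+ :- y₀ :* (s :* e′))
                    refl (sgn k) (esym m (suc k) (y ∘ Fin.suc)) (esym m k (y ∘ Fin.suc)) y₀

-- q e a j is q_{a,j} expressed through the sequence e = (e_0, e_1, …).
q : (ℕ → ℚ) → ℕ → ℕ → ℚ
q e zero    zero    = 1ℚ
q e zero    (suc j) = 0ℚ
q e (suc a) j       = q e a (suc j) ⊕ sgn j * e (suc j) * q e a 0

q-cong : ∀ {e e′} → (∀ k → e k ≡ e′ k) → ∀ a j → q e a j ≡ q e′ a j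
q-cong e≗e′ zero    zero    = refl
q-cong e≗e′ zero    (suc j) = refl
q-cong e≗e′ (suc a) j       =
  cong₂ _⊕_ (q-cong e≗e′ a (suc j)) (cong₂ (λ s t → sgn j * s * t) (e≗e′ (suc j)) (q-cong e≗e′ a 0))

q-vanish : ∀ e n → (∀ k → n < k → e k ≡ 0ℚ) → ∀ a j → n ≤ suc j → q e a (suc j) ≡ 0ℚ
q-vanish e n e-vanish zero    j n≤1+j = refl
q-vanish e n e-vanish (suc a) j n≤1+j = begin
  q e a (suc (suc j)) ⊕ sgn (suc j) * e (suc (suc j)) * q e a 0
    ≡⟨ cong₂ (λ s t → s ⊕ sgn (suc j) * t * q e a 0) (q-vanish e n e-vanish a (suc j) (ℕP.m≤n⇒m≤1+n n≤1+j))
                                                      (e-vanish (suc (suc j)) (s≤s n≤1+j)) ⟩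
  0ℚ ⊕ sgn (suc j) * 0ℚ * q e a 0
    ≡⟨ solve 2 (λ s h → con 0ℚ :+ s :* con 0ℚ :* h := con 0ℚ) refl (sgn (suc j)) (q e a 0) ⟩
  0ℚ ∎
  where open ≡-Reasoning

q-1 : ∀ e j → q e 1 j ≡ sgn j * e (j + 1)
q-1 e j = trans (solve 2 (λ s E → con 0ℚ :+ s :* E :* con 1ℚ := s :* E) refl (sgn j) (e (suc j)))
                (cong (λ k → sgn j * e k) (ℕP.+-comm 1 j))

q-2 : ∀ e j → q e 2 j ≡ - (sgn j * (e (j + 2) - e 1 * e (j + 1)))
q-2 e j = trans (solve 4 (λ s E₂ e₁ E₁ → (con 0ℚ :+ (con (- 1ℚ) :* s) :* E₂ :* con 1ℚ)
                                         :+ s :* E₁ :* (con 0ℚ :+ con 1ℚ :* e₁ :* con 1ℚ)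
                                       := :- (s :* (E₂ :- e₁ :* E₁))) refl (sgn j) (e (2 + j)) (e 1) (e (1 + j)))
                (cong₂ (λ k l → - (sgn j * (e k - e 1 * e l))) (ℕP.+-comm 2 j) (ℕP.+-comm 1 j))

Q-recurrence : ∀ n e → e 0 ≡ 1ℚ → ∀ a z →
  z * evalPoly n (q e (suc a)) z ≡ evalPoly (suc n) (q e a) z - q e a 0 * evalPoly (suc n) (signed e) z
Q-recurrence n e e₀≡1 a z = begin
  z * evalPoly n (q e (suc a)) z ≡⟨ cong (z *_) Q-split ⟩
  z * (R ⊕ h * S)                ≡⟨ solve 4 (λ z R h S → z :* (R :+ h :* S)
                                       := (h :+ z :* R) :- h :* (con 1ℚ :* con 1ℚ :+ z :* (con (- 1ℚ) :* S))) refl z R h S ⟩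
  (h ⊕ z * R) - h * (1ℚ * 1ℚ ⊕ z * (- 1ℚ * S))
    ≡⟨ cong₂ (λ s t → s - h * t) (evalPoly-horner n (q e a) z) E-split ⟨
  evalPoly (suc n) (q e a) z - h * evalPoly (suc n) (signed e) z ∎
  where
  open ≡-Reasoning
  h = q e a 0
  s : ℕ → ℚ
  s j = sgn j * e (suc j)
  R = evalPoly n (q e a ∘ suc) z
  S = evalPoly n s z
  Q-split : evalPoly n (q e (suc a)) z ≡ R ⊕ h * S
  Q-split = trans (evalPoly-cong n (λ j → cong (q e a (suc j) ⊕_) (ℚP.*-comm (s j) h)) z)
                  (trans (evalPoly-+ n (q e a ∘ suc) (λ j → h * s j) z) (cong (R ⊕_) (evalPoly-scale n h s z)))
  E-split : evalPoly (suc n) (signed e) z ≡ 1ℚ * 1ℚ ⊕ z * (- 1ℚ * S)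
  E-split = trans (evalPoly-horner n (signed e) z)
    (cong₂ (λ s t → 1ℚ * s ⊕ z * t) e₀≡1
      (trans (evalPoly-cong n (λ j → ℚP.*-assoc (- 1ℚ) (sgn j) (e (suc j))) z) (evalPoly-scale n (- 1ℚ) s z)))

Q-at-inv : ∀ m y (i : Fin m) → y i ≢ 0ℚ → ∀ a → evalPoly m (q (esyms m y) a) (inv (y i)) ≡ y i ^ a
Q-at-inv (suc m) y i yᵢ≢0 zero = trans (evalPoly-horner m (q (esyms (suc m) y) 0) (inv (y i)))
  (trans (cong (λ t → 1ℚ ⊕ inv (y i) * t) (evalPoly-0 m (inv (y i))))
         (solve 1 (λ z → con 1ℚ :+ z :* con 0ℚ := con 1ℚ) refl (inv (y i))))
Q-at-inv (suc m) y i yᵢ≢0 (suc a) = begin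
  Q (suc a)                               ≡⟨ ℚP.*-identityˡ (Q (suc a)) ⟨
  1ℚ * Q (suc a)                          ≡⟨ cong (_* Q (suc a)) (inv-inverseʳ yᵢ≢0) ⟨
  (y i * z) * Q (suc a)                   ≡⟨ ℚP.*-assoc (y i) z (Q (suc a)) ⟩
  y i * (z * Q (suc a))                   ≡⟨ cong (y i *_) (Q-recurrence (suc m) e refl a z) ⟩
  y i * (evalPoly (suc (suc m)) (q e a) z - q e a 0 * evalPoly (suc (suc m)) (signed e) z)
    ≡⟨ cong₂ (λ s t → y i * (s - q e a 0 * t)) (trans Q-drop (Q-at-inv (suc m) y i yᵢ≢0 a)) E-root ⟩
  y i * (y i ^ a - q e a 0 * 0ℚ)
    ≡⟨ solve 3 (λ y p h → y :* (p :- h :* con 0ℚ) := y :* p) refl (y i) (y i ^ a) (q e a 0) ⟩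
  y i * y i ^ a                           ∎
  where
  open ≡-Reasoning
  e = esyms (suc m) y
  z = inv (y i)
  Q : ℕ → ℚ
  Q b = evalPoly (suc m) (q e b) z
  Q-drop : evalPoly (suc (suc m)) (q e a) z ≡ Q a
  Q-drop = evalPoly-dropTop (suc m) (q e a) (q-vanish e (suc m) (λ k → esym-vanish (suc m) k y) a m ℕP.≤-refl) z
  E-root : evalPoly (suc (suc m)) (signed e) z ≡ 0ℚ
  E-root = trans (evalPoly-signed-esyms (suc m) y z) (prodFin-0 (suc m) {λ l → 1ℚ - z * y l} i (1-x⁻¹*x≡0 yᵢ≢0))

F≡Q : ∀ a m y → AllNonzero y → Distinct y → ∀ z → F a m y z ≡ evalPoly m (q (esyms m y) a) z
F≡Q a m y y≢0 dist = IsPoly<-agree (F-isPoly< a m y) (q (esyms m y) a , λ _ → refl) (inv ∘ y) inv-distinct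
  (λ i → trans (F-at-inv a m y y≢0 dist i) (sym (Q-at-inv m y i (y≢0 i) a)))
  where
  inv-distinct : Distinct (inv ∘ y)
  inv-distinct i l i≢l = dist i l i≢l ∘ inv-injective (y≢0 i) (y≢0 l)

-- Exactness of the degree

mutual
  F-at-0-positive : ∀ b m y → AllPositive y → Distinct y → Positive (F b (suc m) y 0ℚ)
  F-at-0-positive zero m y y>0 dist =
    subst Positive (sym (trans (F≡Q 0 (suc m) y (pos⇒≢0 ∘ y>0) dist 0ℚ) (evalPoly-at-0 m (q (esyms (suc m) y) 0)))) _
  F-at-0-positive (suc b) m y y>0 dist =
    subst Positive (sym (F-cons b m y 0ℚ (pos⇒≢0 ∘ y>0) dist)) (ℚP.pos+nonNeg⇒pos head {{head>0}} tail {{tail≥0}})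
    where
    y₀ = y Fin.zero
    head = y₀ * F b (suc m) y 0ℚ
    tail = (1ℚ - 0ℚ * y₀) * F (suc b) m (y ∘ Fin.suc) 0ℚ
    head>0 : Positive head
    head>0 = ℚP.pos*pos⇒pos y₀ {{y>0 Fin.zero}} (F b (suc m) y 0ℚ) {{F-at-0-positive b m y y>0 dist}}
    tail≥0 : NonNegative tail
    tail≥0 = subst NonNegative
      (solve 2 (λ y₀ t → t := (con 1ℚ :- con 0ℚ :* y₀) :* t) refl y₀ (F (suc b) m (y ∘ Fin.suc) 0ℚ))
                   (F-at-0-nonNegative (suc b) m (y ∘ Fin.suc) (y>0 ∘ Fin.suc) (Distinct-tail dist))

  F-at-0-nonNegative : ∀ b m y → AllPositive y → Distinct y → NonNegative (F b m y 0ℚ)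
  F-at-0-nonNegative b zero    y y>0 dist = _
  F-at-0-nonNegative b (suc m) y y>0 dist = ℚP.pos⇒nonNeg (F b (suc m) y 0ℚ) {{F-at-0-positive b m y y>0 dist}}

q[b,0]-positive : ∀ m y → AllPositive y → Distinct y → ∀ b → Positive (q (esyms (suc m) y) b 0)
q[b,0]-positive m y y>0 dist b =
  subst Positive (trans (F≡Q b (suc m) y (pos⇒≢0 ∘ y>0) dist 0ℚ) (evalPoly-at-0 m (q (esyms (suc m) y) b)))
    (F-at-0-positive b m y y>0 dist)

sgn-≢0 : ∀ n → sgn n ≢ 0ℚ
sgn-≢0 zero    = ℚP.1≢0
sgn-≢0 (suc n) = *-≢0 {x = - 1ℚ} (λ ()) (sgn-≢0 n)

oneToN : ∀ {n} → Fin n → ℚ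
oneToN i = ℚ.mkℚ (ℤ.+ suc (toℕ i)) 0 (Coprime.sym (Coprime.1-coprimeTo (suc (toℕ i))))

oneToN-positive : ∀ {n} → AllPositive (oneToN {n})
oneToN-positive i = _

oneToN-distinct : ∀ {n} → Distinct (oneToN {n})
oneToN-distinct i l i≢l eq = i≢l (FinP.toℕ-injective (ℕP.suc-injective (ℤP.+-injective (cong ℚ.numerator eq))))

q-nonvanishing : ∀ m n a → n < m → ∃ λ y → q (esyms m y) (suc a) n ≢ 0ℚ
q-nonvanishing (suc m) n a n<1+m with ℕP.m<1+n⇒m<n∨m≡n n<1+m
... | inj₂ refl = oneToN , λ q≡0 → *-≢0 (*-≢0 (sgn-≢0 n) eₙ₊₁≢0) h≢0 (trans (sym leading) q≡0)
  where
  e = esyms (suc n) oneToN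
  h≢0 = pos⇒≢0 (q[b,0]-positive n oneToN oneToN-positive oneToN-distinct a)
  eₙ₊₁≢0 : e (suc n) ≢ 0ℚ
  eₙ₊₁≢0 eq = prodFin-≢0 (suc n) {oneToN} (pos⇒≢0 ∘ oneToN-positive) (trans (sym (esym-top (suc n) oneToN)) eq)
  leading : q e (suc a) n ≡ sgn n * e (suc n) * q e a 0
  leading = trans (cong (_⊕ sgn n * e (suc n) * q e a 0)
                        (q-vanish e (suc n) (λ k → esym-vanish (suc n) k oneToN) a n ℕP.≤-refl))
                  (ℚP.+-identityˡ (sgn n * e (suc n) * q e a 0))
... | inj₁ n<m with q-nonvanishing m n a n<m
...   | y , q≢0 = 0ℚ ∷ᶠ y , q≢0 ∘ trans (sym (q-cong (λ k → esym-cons0 m k y) (suc a) n))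

-- Polynomials in Y_1, …, Y_m

^-+ : ∀ x m n → x ^ (m + n) ≡ x ^ m * x ^ n
^-+ x zero    n = sym (ℚP.*-identityˡ (x ^ n))
^-+ x (suc m) n = trans (cong (x *_) (^-+ x m n)) (sym (ℚP.*-assoc x (x ^ m) (x ^ n)))

monomial-0 : ∀ m x → monomial (Vec.replicate m 0) x ≡ 1ℚ
monomial-0 zero    x = refl
monomial-0 (suc m) x = trans (ℚP.*-identityˡ _) (monomial-0 m (x ∘ Fin.suc))

monomial-+ : ∀ {m} (β γ : Vec ℕ m) x → monomial (Vec.zipWith _+_ β γ) x ≡ monomial β x * monomial γ x
monomial-+ []      []      x = sym (ℚP.*-identityˡ 1ℚ)
monomial-+ (b ∷ β) (c ∷ γ) x = trans (cong₂ _*_ (^-+ (x Fin.zero) b c) (monomial-+ β γ (x ∘ Fin.suc)))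
  (*-interchange (x Fin.zero ^ b) (x Fin.zero ^ c) (monomial β (x ∘ Fin.suc)) (monomial γ (x ∘ Fin.suc)))

monomial-updateAt-suc : ∀ {m} (β : Vec ℕ m) k x → monomial (Vec.updateAt β k suc) x ≡ x k * monomial β x
monomial-updateAt-suc (b ∷ β) Fin.zero    x = ℚP.*-assoc (x Fin.zero) (x Fin.zero ^ b) _
monomial-updateAt-suc (b ∷ β) (Fin.suc k) x = trans (cong (x Fin.zero ^ b *_) (monomial-updateAt-suc β k (x ∘ Fin.suc)))
  (solve 3 (λ p q r → p :* (q :* r) := q :* (p :* r)) refl (x Fin.zero ^ b) (x (Fin.suc k)) (monomial β (x ∘ Fin.suc)))

totalDeg-0 : ∀ m → totalDeg (Vec.replicate m 0) ≡ 0
totalDeg-0 zero    = refl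
totalDeg-0 (suc m) = totalDeg-0 m

totalDeg-+ : ∀ {m} (β γ : Vec ℕ m) → totalDeg (Vec.zipWith _+_ β γ) ≡ totalDeg β + totalDeg γ
totalDeg-+ []      []      = refl
totalDeg-+ (b ∷ β) (c ∷ γ) = trans (cong (b + c +_) (totalDeg-+ β γ))
  (ℕ+-interchange b c (totalDeg β) (totalDeg γ))

oneP : ∀ {R} m → R → Poly R m
oneP m c = (c , Vec.replicate m 0) ∷ []

scaleP : ∀ {m} → ℚ → Poly ℚ m → Poly ℚ m
scaleP c = List.map (Product.map₁ (c *_))

termMulP : ∀ {m} → ℚ → Vec ℕ m → Poly ℚ m → Poly ℚ m
termMulP c β = List.map (λ (d , γ) → c * d , Vec.zipWith _+_ β γ)

mulP : ∀ {m} → Poly ℚ m → Poly ℚ m → Poly ℚ m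
mulP p r = List.concatMap (λ (c , β) → termMulP c β r) p

lift₀ lift₁ : ∀ {R m} → Poly R m → Poly R (suc m)
lift₀ = List.map (Product.map₂ (0 ∷_))
lift₁ = List.map (Product.map₂ (1 ∷_))

esymPoly : (m k : ℕ) → Poly ℚ m
esymPoly m       zero    = oneP m 1ℚ
esymPoly zero    (suc k) = []
esymPoly (suc m) (suc k) = lift₀ (esymPoly m (suc k)) ++ lift₁ (esymPoly m k)

qPoly : (m a j : ℕ) → Poly ℚ m
qPoly m zero    zero    = oneP m 1ℚ
qPoly m zero    (suc j) = []
qPoly m (suc a) j       = qPoly m a (suc j) ++ scaleP (sgn j) (mulP (esymPoly m (suc j)) (qPoly m a 0))

evalℚ-oneP : ∀ m c x → evalℚ (oneP m c) x ≡ c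
evalℚ-oneP m c x = trans (ℚP.+-identityʳ _) (trans (cong (c *_) (monomial-0 m x)) (ℚP.*-identityʳ c))

evalℚ-++ : ∀ {m} (p r : Poly ℚ m) x → evalℚ (p ++ r) x ≡ evalℚ p x ⊕ evalℚ r x
evalℚ-++ []            r x = sym (ℚP.+-identityˡ _)
evalℚ-++ ((c , β) ∷ p) r x =
  trans (cong (c * monomial β x ⊕_) (evalℚ-++ p r x)) (sym (ℚP.+-assoc (c * monomial β x) (evalℚ p x) (evalℚ r x)))

evalℚ-scaleP : ∀ {m} c (p : Poly ℚ m) x → evalℚ (scaleP c p) x ≡ c * evalℚ p x
evalℚ-scaleP c []            x = sym (ℚP.*-zeroʳ c)
evalℚ-scaleP c ((d , β) ∷ p) x = trans (cong (c * d * monomial β x ⊕_) (evalℚ-scaleP c p x))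
  (solve 4 (λ c d M E → c :* d :* M :+ c :* E := c :* (d :* M :+ E)) refl c d (monomial β x) (evalℚ p x))

evalℚ-termMulP : ∀ {m} c β (r : Poly ℚ m) x → evalℚ (termMulP c β r) x ≡ c * monomial β x * evalℚ r x
evalℚ-termMulP c β []            x = sym (ℚP.*-zeroʳ (c * monomial β x))
evalℚ-termMulP c β ((d , γ) ∷ r) x = trans (cong₂ _⊕_ (cong (c * d *_) (monomial-+ β γ x)) (evalℚ-termMulP c β r x))
  (solve 5 (λ c d M N E → c :* d :* (M :* N) :+ c :* M :* E := c :* M :* (d :* N :+ E)) refl
     c d (monomial β x) (monomial γ x) (evalℚ r x))

evalℚ-mulP : ∀ {m} (p r : Poly ℚ m) x → evalℚ (mulP p r) x ≡ evalℚ p x * evalℚ r x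
evalℚ-mulP []            r x = sym (ℚP.*-zeroˡ (evalℚ r x))
evalℚ-mulP ((c , β) ∷ p) r x = begin
  evalℚ (termMulP c β r ++ mulP p r) x                      ≡⟨ evalℚ-++ (termMulP c β r) (mulP p r) x ⟩
  evalℚ (termMulP c β r) x ⊕ evalℚ (mulP p r) x             ≡⟨ cong₂ _⊕_ (evalℚ-termMulP c β r x) (evalℚ-mulP p r x) ⟩
  c * monomial β x * evalℚ r x ⊕ evalℚ p x * evalℚ r x       ≡⟨ ℚP.*-distribʳ-+ (evalℚ r x) (c * monomial β x) (evalℚ p x) ⟨
  (c * monomial β x ⊕ evalℚ p x) * evalℚ r x                 ∎
  where open ≡-Reasoning

evalℚ-lift₀ : ∀ {m} (p : Poly ℚ m) x → evalℚ (lift₀ p) x ≡ evalℚ p (x ∘ Fin.suc)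
evalℚ-lift₀ []            x = refl
evalℚ-lift₀ ((c , β) ∷ p) x = cong₂ _⊕_ (cong (c *_) (ℚP.*-identityˡ _)) (evalℚ-lift₀ p x)

evalℚ-lift₁ : ∀ {m} (p : Poly ℚ m) x → evalℚ (lift₁ p) x ≡ x Fin.zero * evalℚ p (x ∘ Fin.suc)
evalℚ-lift₁ []            x = sym (ℚP.*-zeroʳ (x Fin.zero))
evalℚ-lift₁ ((c , β) ∷ p) x = trans (cong (c * monomial {suc _} (1 ∷ β) x ⊕_) (evalℚ-lift₁ p x))
  (solve 4 (λ c y M E → c :* (y :* con 1ℚ :* M) :+ y :* E := y :* (c :* M :+ E)) refl
     c (x Fin.zero) (monomial β (x ∘ Fin.suc)) (evalℚ p (x ∘ Fin.suc)))

evalℚ-esymPoly : ∀ m k x → evalℚ (esymPoly m k) x ≡ esym m k x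
evalℚ-esymPoly m       zero    x = evalℚ-oneP m 1ℚ x
evalℚ-esymPoly zero    (suc k) x = refl
evalℚ-esymPoly (suc m) (suc k) x = trans (evalℚ-++ (lift₀ (esymPoly m (suc k))) (lift₁ (esymPoly m k)) x)
  (cong₂ _⊕_ (trans (evalℚ-lift₀ (esymPoly m (suc k)) x) (evalℚ-esymPoly m (suc k) (x ∘ Fin.suc)))
             (trans (evalℚ-lift₁ (esymPoly m k) x) (cong (x Fin.zero *_) (evalℚ-esymPoly m k (x ∘ Fin.suc)))))

evalℚ-qPoly : ∀ m a j x → evalℚ (qPoly m a j) x ≡ q (esyms m x) a j
evalℚ-qPoly m zero    zero    x = evalℚ-oneP m 1ℚ x
evalℚ-qPoly m zero    (suc j) x = refl
evalℚ-qPoly m (suc a) j       x = begin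
  evalℚ (qPoly m a (suc j) ++ scaleP (sgn j) (mulP Eⱼ₊₁ Q₀)) x
    ≡⟨ evalℚ-++ (qPoly m a (suc j)) (scaleP (sgn j) (mulP Eⱼ₊₁ Q₀)) x ⟩
  evalℚ (qPoly m a (suc j)) x ⊕ evalℚ (scaleP (sgn j) (mulP Eⱼ₊₁ Q₀)) x
    ≡⟨ cong (evalℚ (qPoly m a (suc j)) x ⊕_) (evalℚ-scaleP (sgn j) (mulP Eⱼ₊₁ Q₀) x) ⟩
  evalℚ (qPoly m a (suc j)) x ⊕ sgn j * evalℚ (mulP Eⱼ₊₁ Q₀) x
    ≡⟨ cong (λ t → evalℚ (qPoly m a (suc j)) x ⊕ sgn j * t) (evalℚ-mulP Eⱼ₊₁ Q₀ x) ⟩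
  evalℚ (qPoly m a (suc j)) x ⊕ sgn j * (evalℚ Eⱼ₊₁ x * evalℚ Q₀ x)
    ≡⟨ cong₂ (λ s t → s ⊕ sgn j * t) (evalℚ-qPoly m a (suc j) x)
             (cong₂ _*_ (evalℚ-esymPoly m (suc j) x) (evalℚ-qPoly m a 0 x)) ⟩
  q e a (suc j) ⊕ sgn j * (e (suc j) * q e a 0)
    ≡⟨ cong (q e a (suc j) ⊕_) (ℚP.*-assoc (sgn j) (e (suc j)) (q e a 0)) ⟨
  q e (suc a) j ∎
  where
  open ≡-Reasoning
  e = esyms m x
  Eⱼ₊₁ = esymPoly m (suc j)
  Q₀ = qPoly m a 0

Homogeneous : ∀ {m} → ℕ → Poly ℚ m → Set
Homogeneous d = All (λ t → totalDeg (proj₂ t) ≡ d)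

Homogeneous-oneP : ∀ m c → Homogeneous 0 (oneP m c)
Homogeneous-oneP m c = totalDeg-0 m ∷ []

Homogeneous-termMulP : ∀ {m d₁ d₂} c (β : Vec ℕ m) {r} → totalDeg β ≡ d₁ → Homogeneous d₂ r →
  Homogeneous (d₁ + d₂) (termMulP c β r)
Homogeneous-termMulP c β degβ hr = AllP.map⁺ (All.map (λ {(_ , γ)} degγ → trans (totalDeg-+ β γ) (cong₂ _+_ degβ degγ)) hr)

Homogeneous-mulP : ∀ {m d₁ d₂} {p r : Poly ℚ m} → Homogeneous d₁ p → Homogeneous d₂ r →
  Homogeneous (d₁ + d₂) (mulP p r)
Homogeneous-mulP hp hr = AllP.concat⁺ (AllP.map⁺ (All.map (λ {(c , β)} degβ → Homogeneous-termMulP c β degβ hr) hp))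

Homogeneous-esymPoly : ∀ m k → Homogeneous k (esymPoly m k)
Homogeneous-esymPoly m       zero    = Homogeneous-oneP m 1ℚ
Homogeneous-esymPoly zero    (suc k) = []
Homogeneous-esymPoly (suc m) (suc k) =
  AllP.++⁺ (AllP.map⁺ (Homogeneous-esymPoly m (suc k))) (AllP.map⁺ (All.map (cong suc) (Homogeneous-esymPoly m k)))

Homogeneous-qPoly : ∀ m a j → Homogeneous (j + a) (qPoly m a j)
Homogeneous-qPoly m zero    zero    = Homogeneous-oneP m 1ℚ
Homogeneous-qPoly m zero    (suc j) = []
Homogeneous-qPoly m (suc a) j       = subst (λ d → Homogeneous d (qPoly m (suc a) j)) (sym (ℕP.+-suc j a))
  (AllP.++⁺ (Homogeneous-qPoly m a (suc j))
           (AllP.map⁺ (Homogeneous-mulP (Homogeneous-esymPoly m (suc j)) (Homogeneous-qPoly m a 0))))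

Homogeneous-coeff : ∀ {m d} (p : Poly ℚ m) → Homogeneous d p → ∀ α → coeff p α ≢ 0ℚ → totalDeg α ≡ d
Homogeneous-coeff []            hp             α c≢0 = ⊥-elim (c≢0 refl)
Homogeneous-coeff ((c , β) ∷ p) (degβ ∷ hp) α c≢0 with ≡-dec ℕ._≟_ β α
... | yes refl = degβ
... | no  _    = Homogeneous-coeff p hp α c≢0

coeff-listed : ∀ {m} (p : Poly ℚ m) α → coeff p α ≢ 0ℚ → Any (λ t → proj₂ t ≡ α) p
coeff-listed []            α c≢0 = ⊥-elim (c≢0 refl)
coeff-listed ((c , β) ∷ p) α c≢0 with ≡-dec ℕ._≟_ β α
... | yes β≡α = here β≡α
... | no  _   = there (coeff-listed p α c≢0)

remove : ∀ {m} → Vec ℕ m → Poly ℚ m → Poly ℚ m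
remove α []            = []
remove α ((c , β) ∷ p) with ≡-dec ℕ._≟_ β α
... | yes _ = remove α p
... | no  _ = (c , β) ∷ remove α p

evalℚ-remove : ∀ {m} α (p : Poly ℚ m) x → evalℚ p x ≡ coeff p α * monomial α x ⊕ evalℚ (remove α p) x
evalℚ-remove α [] x = sym (trans (cong (_⊕ 0ℚ) (ℚP.*-zeroˡ (monomial α x))) (ℚP.+-identityˡ 0ℚ))
evalℚ-remove α ((c , β) ∷ p) x with ≡-dec ℕ._≟_ β α
... | yes refl = trans (cong (c * monomial α x ⊕_) (evalℚ-remove α p x))
  (solve 4 (λ c M k E → c :* M :+ (k :* M :+ E) := (c :+ k) :* M :+ E) refl
     c (monomial α x) (coeff p α) (evalℚ (remove α p) x))
... | no  _    = trans (cong (c * monomial β x ⊕_) (evalℚ-remove α p x))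
  (solve 4 (λ a k M E → a :+ (k :* M :+ E) := k :* M :+ (a :+ E)) refl
     (c * monomial β x) (coeff p α) (monomial α x) (evalℚ (remove α p) x))

coeff-∷-≢ : ∀ {m} c (β α : Vec ℕ m) p → β ≢ α → coeff ((c , β) ∷ p) α ≡ coeff p α
coeff-∷-≢ c β α p β≢α with ≡-dec ℕ._≟_ β α
... | yes β≡α = ⊥-elim (β≢α β≡α)
... | no  _   = refl

coeff-∷-≡ : ∀ {m} c (α : Vec ℕ m) p → coeff ((c , α) ∷ p) α ≡ c ⊕ coeff p α
coeff-∷-≡ c α p with ≡-dec ℕ._≟_ α α
... | yes _   = refl
... | no  α≢α = ⊥-elim (α≢α refl)

coeff-remove-≡ : ∀ {m} α (p : Poly ℚ m) → coeff (remove α p) α ≡ 0ℚ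
coeff-remove-≡ α []            = refl
coeff-remove-≡ α ((c , β) ∷ p) with ≡-dec ℕ._≟_ β α
... | yes _   = coeff-remove-≡ α p
... | no  β≢α = trans (coeff-∷-≢ c β α (remove α p) β≢α) (coeff-remove-≡ α p)

coeff-remove-≢ : ∀ {m} α γ (p : Poly ℚ m) → γ ≢ α → coeff (remove α p) γ ≡ coeff p γ
coeff-remove-≢ α γ []            γ≢α = refl
coeff-remove-≢ α γ ((c , β) ∷ p) γ≢α with ≡-dec ℕ._≟_ β α
... | yes refl = trans (coeff-remove-≢ α γ p γ≢α) (sym (coeff-∷-≢ c β γ p (γ≢α ∘ sym)))
... | no  _    with ≡-dec ℕ._≟_ β γ
...   | yes _ = cong (c ⊕_) (coeff-remove-≢ α γ p γ≢α)
...   | no  _ = coeff-remove-≢ α γ p γ≢α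

length-remove : ∀ {m} α (p : Poly ℚ m) → List.length (remove α p) ≤ List.length p
length-remove α []            = z≤n
length-remove α ((c , β) ∷ p) with ≡-dec ℕ._≟_ β α
... | yes _ = ℕP.m≤n⇒m≤1+n (length-remove α p)
... | no  _ = s≤s (length-remove α p)

-- The recursive call is on remove β p, which is not a sublist of the input; n bounds the length.
coeff-0⇒evalℚ-0 : ∀ {m} n (p : Poly ℚ m) → List.length p ≤ n → (∀ α → coeff p α ≡ 0ℚ) →
  ∀ x → evalℚ p x ≡ 0ℚ
coeff-0⇒evalℚ-0 n       []            _           coeffs≡0 x = refl
coeff-0⇒evalℚ-0 (suc n) ((c , β) ∷ p) (s≤s |p|≤n) coeffs≡0 x = begin
  c * monomial β x ⊕ evalℚ p x
    ≡⟨ cong (c * monomial β x ⊕_) (evalℚ-remove β p x) ⟩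
  c * monomial β x ⊕ (coeff p β * monomial β x ⊕ evalℚ (remove β p) x)
    ≡⟨ solve 4 (λ c k M E → c :* M :+ (k :* M :+ E) := (c :+ k) :* M :+ E) refl
         c (coeff p β) (monomial β x) (evalℚ (remove β p) x) ⟩
  (c ⊕ coeff p β) * monomial β x ⊕ evalℚ (remove β p) x
    ≡⟨ cong₂ (λ s t → s * monomial β x ⊕ t) (trans (sym (coeff-∷-≡ c β p)) (coeffs≡0 β))
             (coeff-0⇒evalℚ-0 n (remove β p) (ℕP.≤-trans (length-remove β p) |p|≤n) remaining≡0 x) ⟩
  0ℚ * monomial β x ⊕ 0ℚ
    ≡⟨ solve 1 (λ M → con 0ℚ :* M :+ con 0ℚ := con 0ℚ) refl (monomial β x) ⟩
  0ℚ ∎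
  where
  open ≡-Reasoning
  remaining≡0 : ∀ γ → coeff (remove β p) γ ≡ 0ℚ
  remaining≡0 γ with ≡-dec ℕ._≟_ γ β
  ... | yes refl = coeff-remove-≡ β p
  ... | no  γ≢β  =
    trans (coeff-remove-≢ β γ p γ≢β) (trans (sym (coeff-∷-≢ c β γ p (γ≢β ∘ sym))) (coeffs≡0 γ))

evalℚ-≢0⇒coeff-≢0 : ∀ {m} (p : Poly ℚ m) x → evalℚ p x ≢ 0ℚ → ∃ λ α → coeff p α ≢ 0ℚ
evalℚ-≢0⇒coeff-≢0 p x p[x]≢0 with Any.any? (λ t → ¬? (coeff p (proj₂ t) ℚP.≟ 0ℚ)) p
... | yes listed = let (_ , β) , c≢0 = Any.satisfied listed in β , c≢0
... | no  none   = ⊥-elim (p[x]≢0 (coeff-0⇒evalℚ-0 (List.length p) p ℕP.≤-refl coeffs≡0 x))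
  where
  coeffs≡0 : ∀ α → coeff p α ≡ 0ℚ
  coeffs≡0 α with coeff p α ℚP.≟ 0ℚ
  ... | yes c≡0 = c≡0
  ... | no  c≢0 = ⊥-elim (none (Any.map (λ t≡α → subst (λ β → coeff p β ≢ 0ℚ) (sym t≡α) c≢0)
                                         (coeff-listed p α c≢0)))

Homogeneous⇒HasDegree : ∀ {m d} (p : Poly ℚ m) → Homogeneous d p → ∀ x → evalℚ p x ≢ 0ℚ → HasDegree p d
Homogeneous⇒HasDegree p hp x p[x]≢0 =
  (λ α c≢0 → ℕP.≤-reflexive (Homogeneous-coeff p hp α c≢0)) ,
  Product.map₂ (λ {α} c≢0 → Homogeneous-coeff p hp α c≢0 , c≢0) (evalℚ-≢0⇒coeff-≢0 p x p[x]≢0)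

-- Integer polynomials in e_1, …, e_m

negP : ∀ {m} → Poly ℤ m → Poly ℤ m
negP = List.map (Product.map₁ (λ c → ℤ.- c))

signP : ∀ {m} → ℕ → Poly ℤ m → Poly ℤ m
signP zero    p = p
signP (suc j) p = negP (signP j p)

mulVarP : ∀ {m} → Fin m → Poly ℤ m → Poly ℤ m
mulVarP k = List.map (Product.map₂ (λ β → Vec.updateAt β k suc))

-- Variable k of a Poly ℤ m stands for e_{k+1}; e_{j+1} = 0 for j ≥ m.
mulEP : (m j : ℕ) → Poly ℤ m → Poly ℤ m
mulEP m j p with j ℕ.<? m
... | yes j<m = mulVarP (Fin.fromℕ< j<m) p
... | no  _   = []

qPolyℤ : (m a j : ℕ) → Poly ℤ m
qPolyℤ m zero    zero    = oneP m (ℤ.+ 1)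
qPolyℤ m zero    (suc j) = []
qPolyℤ m (suc a) j       = qPolyℤ m a (suc j) ++ signP j (mulEP m j (qPolyℤ m a 0))

esymVars : (m : ℕ) → (Fin m → ℚ) → Fin m → ℚ
esymVars m y k = esym m (toℕ k + 1) y

-[c]/1≡-[c/1] : ∀ c → (ℤ.- c) ℚ./ 1 ≡ - (c ℚ./ 1)
-[c]/1≡-[c/1] (ℤ.+ zero)  = refl
-[c]/1≡-[c/1] (ℤ.+ suc n) = refl
-[c]/1≡-[c/1] ℤ.-[1+ n ]  = sym (GroupProperties.⁻¹-involutive ℚP.+-0-group (ℚ.normalize (suc n) 1))

evalℤ-++ : ∀ {m} (p r : Poly ℤ m) x → evalℤ (p ++ r) x ≡ evalℤ p x ⊕ evalℤ r x
evalℤ-++ []            r x = sym (ℚP.+-identityˡ _)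
evalℤ-++ ((c , β) ∷ p) r x = trans (cong (c ℚ./ 1 * monomial β x ⊕_) (evalℤ-++ p r x))
  (sym (ℚP.+-assoc (c ℚ./ 1 * monomial β x) (evalℤ p x) (evalℤ r x)))

evalℤ-negP : ∀ {m} (p : Poly ℤ m) x → evalℤ (negP p) x ≡ - evalℤ p x
evalℤ-negP []            x = refl
evalℤ-negP ((c , β) ∷ p) x = trans (cong₂ _⊕_ (cong (_* monomial β x) (-[c]/1≡-[c/1] c)) (evalℤ-negP p x))
  (solve 3 (λ c M E → :- c :* M :+ :- E := :- (c :* M :+ E)) refl (c ℚ./ 1) (monomial β x) (evalℤ p x))

evalℤ-signP : ∀ {m} j (p : Poly ℤ m) x → evalℤ (signP j p) x ≡ sgn j * evalℤ p x
evalℤ-signP zero    p x = sym (ℚP.*-identityˡ _)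
evalℤ-signP (suc j) p x = trans (evalℤ-negP (signP j p) x) (trans (cong -_ (evalℤ-signP j p x))
  (solve 2 (λ s E → :- (s :* E) := (con (- 1ℚ) :* s) :* E) refl (sgn j) (evalℤ p x)))

evalℤ-mulVarP : ∀ {m} k (p : Poly ℤ m) x → evalℤ (mulVarP k p) x ≡ x k * evalℤ p x
evalℤ-mulVarP k []            x = sym (ℚP.*-zeroʳ (x k))
evalℤ-mulVarP k ((c , β) ∷ p) x =
  trans (cong₂ _⊕_ (cong (c ℚ./ 1 *_) (monomial-updateAt-suc β k x)) (evalℤ-mulVarP k p x))
  (solve 4 (λ c t M E → c :* (t :* M) :+ t :* E := t :* (c :* M :+ E)) refl (c ℚ./ 1) (x k) (monomial β x) (evalℤ p x))

evalℤ-mulEP : ∀ m j (p : Poly ℤ m) y →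
  evalℤ (mulEP m j p) (esymVars m y) ≡ esym m (suc j) y * evalℤ p (esymVars m y)
evalℤ-mulEP m j p y with j ℕ.<? m
... | yes j<m = trans (evalℤ-mulVarP (Fin.fromℕ< j<m) p _)
                      (cong (λ k → esym m k y * evalℤ p (esymVars m y))
                            (trans (cong (_+ 1) (FinP.toℕ-fromℕ< j<m)) (ℕP.+-comm j 1)))
... | no  j≮m = sym (trans (cong (_* evalℤ p (esymVars m y)) (esym-vanish m (suc j) y (s≤s (ℕP.≮⇒≥ j≮m))))
                           (ℚP.*-zeroˡ (evalℤ p (esymVars m y))))

evalℤ-qPolyℤ : ∀ m a j y → evalℤ (qPolyℤ m a j) (esymVars m y) ≡ q (esyms m y) a j
evalℤ-qPolyℤ m zero    zero    y = evalℚ-oneP m 1ℚ (esymVars m y)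
evalℤ-qPolyℤ m zero    (suc j) y = refl
evalℤ-qPolyℤ m (suc a) j       y = begin
  evalℤ (qPolyℤ m a (suc j) ++ signP j (mulEP m j (qPolyℤ m a 0))) X
    ≡⟨ evalℤ-++ (qPolyℤ m a (suc j)) (signP j (mulEP m j (qPolyℤ m a 0))) X ⟩
  evalℤ (qPolyℤ m a (suc j)) X ⊕ evalℤ (signP j (mulEP m j (qPolyℤ m a 0))) X
    ≡⟨ cong₂ _⊕_ (evalℤ-qPolyℤ m a (suc j) y)
                 (trans (evalℤ-signP j (mulEP m j (qPolyℤ m a 0)) X)
                        (cong (sgn j *_) (evalℤ-mulEP m j (qPolyℤ m a 0) y))) ⟩
  q e a (suc j) ⊕ sgn j * (esym m (suc j) y * evalℤ (qPolyℤ m a 0) X)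
    ≡⟨ cong (λ t → q e a (suc j) ⊕ sgn j * (esym m (suc j) y * t)) (evalℤ-qPolyℤ m a 0 y) ⟩
  q e a (suc j) ⊕ sgn j * (e (suc j) * q e a 0)
    ≡⟨ cong (q e a (suc j) ⊕_) (ℚP.*-assoc (sgn j) (e (suc j)) (q e a 0)) ⟨
  q e (suc a) j ∎
  where
  open ≡-Reasoning
  X = esymVars m y
  e = esyms m y

lemma6p2 : (a m : ℕ) → 1 ≤ a →
    Σ (Fin m → Poly ℚ m) λ q →
      ((y : Fin m → ℚ) → (z : ℚ) →
         (∀ i → y i ≢ 0ℚ) → (∀ i l → i ≢ l → y i ≢ y l) →
         F a m y z ≡ sumFin m (λ j → evalℚ (q j) y * (z ^ toℕ j)))
      × (∀ j → HasDegree (q j) (toℕ j + a))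
      × (∀ j → ∃ λ (P : Poly ℤ m) →
           ∀ y → evalℚ (q j) y ≡ evalℤ P (λ k → esym m (toℕ k + 1) y))
      × (a ≡ 1 → ∀ j y → evalℚ (q j) y ≡ sgn (toℕ j) * esym m (toℕ j + 1) y)
      × (a ≡ 2 → ∀ j y → evalℚ (q j) y ≡
           - (sgn (toℕ j) * (esym m (toℕ j + 2) y - esym m 1 y * esym m (toℕ j + 1) y)))
lemma6p2 a@(suc a-1) m (s≤s z≤n) = qₐ , expansion , degree , integral , (λ { refl → a≡1 }) , (λ { refl → a≡2 })
  where
  qₐ : Fin m → Poly ℚ m
  qₐ j = qPoly m a (toℕ j)
  evalℚ-qₐ : ∀ j y → evalℚ (qₐ j) y ≡ q (esyms m y) a (toℕ j)
  evalℚ-qₐ j = evalℚ-qPoly m a (toℕ j)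
  expansion : ∀ y z → AllNonzero y → Distinct y → F a m y z ≡ sumFin m (λ j → evalℚ (qₐ j) y * z ^ toℕ j)
  expansion y z y≢0 dist =
    trans (F≡Q a m y y≢0 dist z) (sym (sumFin-cong m (λ j → cong (_* z ^ toℕ j) (evalℚ-qₐ j y))))
  degree : ∀ j → HasDegree (qₐ j) (toℕ j + a)
  degree j = let y , q≢0 = q-nonvanishing m (toℕ j) a-1 (FinP.toℕ<n j) in
    Homogeneous⇒HasDegree (qₐ j) (Homogeneous-qPoly m a (toℕ j)) y (q≢0 ∘ trans (sym (evalℚ-qₐ j y)))
  integral : ∀ j → ∃ λ P → ∀ y → evalℚ (qₐ j) y ≡ evalℤ P (esymVars m y)
  integral j = qPolyℤ m a (toℕ j) , λ y → trans (evalℚ-qₐ j y) (sym (evalℤ-qPolyℤ m a (toℕ j) y))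
  a≡1 : ∀ (j : Fin m) y → evalℚ (qPoly m 1 (toℕ j)) y ≡ sgn (toℕ j) * esym m (toℕ j + 1) y
  a≡1 j y = trans (evalℚ-qPoly m 1 (toℕ j) y) (q-1 (esyms m y) (toℕ j))
  a≡2 : ∀ (j : Fin m) y → evalℚ (qPoly m 2 (toℕ j)) y ≡
    - (sgn (toℕ j) * (esym m (toℕ j + 2) y - esym m 1 y * esym m (toℕ j + 1) y))
  a≡2 j y = trans (evalℚ-qPoly m 2 (toℕ j) y) (q-2 (esyms m y) (toℕ j))
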